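{- Let $G=(V,E,u)$ be an $n$-vertex graph, let $j,L\le n$ be positive integers and let $n=j_0>j_1>\dots>j_L=j$ be a strictly decreasing sequence of integers. Let $\mathcal H_0,\dots,\mathcal H_L$ be an $(L,j)$-hierarchy of $G$ with respect to this sequence, and let $H_0,H_1,\dots,H_L$ be a chain in this hierarchy. For $1\le i\le L$ write $H_i=C_i\cup F_i$ with core $C_i$ and forest $F_i$, and let $\widetilde C_i=\widetilde C(H_i)$ be the $2$-approximate sparsified core associated with $H_i$ in the hierarchy. Then the graph $$H^{H_0,\dots,H_L}:=\widetilde C_L\cup F_L\cup F_{L-1}\cup\dots\cup F_1$$ is an $O(j)$-tree on the vertex set $V$.
   Context: A $k$-tree on a vertex set $W$ is a graph $H=C\cup F$ on $W$ consisting of a core $C$, a graph on a vertex subset $V(C)\subseteq W$ with $|V(C)|\le k$, and a forest $F$ on $W$ in which every connected component (tree) contains exactly one vertex of $V(C)$ (its root); an $O(k)$-tree is a $k'$-tree with $k'=O(k)$ (core of size at most a fixed constant times $k$). For a graph $H$, $U_H(S)$ denotes the total capacity of edges of $H$ crossing the cut $(S,\cdot\setminus S)$. A $2$-approximate sparsified core of a $k$-tree $H=C\cup F$ is a graph $\widetilde C$ on the vertex set $V(C)$ that is a $2$-approximate cut sparsifier of $C$ (all cut values of $C$ preserved up to a factor $2$); the trivial $n$-tree of $G$ is $G$ itself viewed as a core on all of $V$ with the empty forest. An $(L,j)$-hierarchy of $G$ (for the sequence $j_0>\dots>j_L$) is a sequence of sets $\mathcal H_0,\dots,\mathcal H_L$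 such that: (1) $\mathcal H_0=\{G\}$, $G$ treated as the trivial $n$-tree, with an associated $2$-approximate cut sparsifier $\widetilde C(G)$ of $G$; (2) for every $1\le i\le L$ and every $H_i\in\mathcal H_i$ there is a unique parent $H_{i-1}\in\mathcal H_{i-1}$ such that $H_i$ is an $O(j_i)$-tree on the vertex set of $\widetilde C(H_{i-1})$, and each $H_i$ has an associated $2$-approximate sparsified core $\widetilde C(H_i)$. A chain is a sequence $H_0,\dots,H_L$ with $H_i\in\mathcal H_i$ and $H_{i-1}$ the parent of $H_i$ for each $1\le i\le L$.
   Formalization: The edge capacities of G, and of all cores, forests and sparsified cores in the hierarchy, are rational. -}

module Defs where

open import Data.Nat using (ℕ; zero; suc; _*_) renaming (_≤_ to _≤ₙ_)
open import Data.Fin using (Fin; zero; suc; inject₁; fromℕ)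
open import Data.Fin.Subset using (Subset; _∈_; _⊆_; ∣_∣)
  renaming (⊤ to ⊤ˢ; ⊥ to ⊥ˢ; _∪_ to _∪ˢ_)
open import Data.Rational using (ℚ; 0ℚ; 1ℚ; _+_; _≤_; _<_)
open import Data.Vec using (lookup)
open import Data.Bool using (Bool; true; false; _∧_; not; if_then_else_)
open import Data.List using (List; []; _∷_; _++_; [_]; length; map; foldr; allFin)
open import Data.List.Relation.Unary.Unique.Propositional using (Unique)
open import Data.List.Relation.Unary.Linked using (Linked)
open import Data.Product using (Σ; _×_)
open import Relation.Binary.PropositionalEquality using (_≡_)
open import Relation.Nullary using (¬_)

-- A graph is a vertex set together with a capacity function; u,v are
-- adjacent iff their capacity is positive (simple undirected graphs).

record Graph (n : ℕ) : Set where
  field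
    vset : Subset n
    cap  : Fin n → Fin n → ℚ
open Graph public

record IsGraph {n : ℕ} (G : Graph n) : Set where
  field
    cap-nonneg : ∀ u v → 0ℚ ≤ cap G u v
    cap-sym    : ∀ u v → cap G u v ≡ cap G v u
    cap-loop   : ∀ u → cap G u u ≡ 0ℚ
    cap-supp   : ∀ u v → 0ℚ < cap G u v → (u ∈ vset G) × (v ∈ vset G)

Edge : {n : ℕ} → Graph n → Fin n → Fin n → Set
Edge G u v = 0ℚ < cap G u v

_∪ᴳ_ : {n : ℕ} → Graph n → Graph n → Graph n
G ∪ᴳ H = record { vset = vset G ∪ˢ vset H ; cap = λ u v → cap G u v + cap H u v }

emptyGraph : {n : ℕ} → Graph n
emptyGraph = record { vset = ⊥ˢ ; cap = λ _ _ → 0ℚ }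

SameGraph : {n : ℕ} → Graph n → Graph n → Set
SameGraph G H = (vset G ≡ vset H) × (∀ u v → cap G u v ≡ cap H u v)

data Reach {n : ℕ} (G : Graph n) : Fin n → Fin n → Set where
  here : ∀ {u} → Reach G u u
  step : ∀ {u w v} → Edge G u w → Reach G w v → Reach G u v

Acyclic : {n : ℕ} → Graph n → Set
Acyclic G = ∀ x xs → 2 ≤ₙ length xs → Unique (x ∷ xs) →
            ¬ Linked (Edge G) (x ∷ xs ++ [ x ])

-- k-tree on W with core C and forest F (H = C ∪ F)
record IsKTree {n : ℕ} (k : ℕ) (W : Subset n) (C F : Graph n) : Set where
  field
    core-graph   : IsGraph C
    forest-graph : IsGraph F
    core-sub     : vset C ⊆ W
    core-size    : ∣ vset C ∣ ≤ₙ k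
    forest-on    : vset F ≡ W
    forest-acyc  : Acyclic F
    -- every component of F contains exactly one vertex of V(C)
    root-exists  : ∀ v → v ∈ W → Σ (Fin n) λ r → (r ∈ vset C) × Reach F v r
    root-unique  : ∀ v r r' → v ∈ W → r ∈ vset C → Reach F v r →
                   r' ∈ vset C → Reach F v r' → r ≡ r'

sumℚ : List ℚ → ℚ
sumℚ = foldr _+_ 0ℚ

cutVal : {n : ℕ} → Graph n → Subset n → ℚ
cutVal {n} G S = sumℚ (map (λ u → sumℚ (map (λ v →
  if lookup S u ∧ not (lookup S v) then cap G u v else 0ℚ) (allFin n))) (allFin n))

record IsSparsifier2 {n : ℕ} (C C̃ : Graph n) : Set where
  field
    sp-graph : IsGraph C̃
    sp-vset  : vset C̃ ≡ vset C
    sp-lower : ∀ S → cutVal C S ≤ cutVal C̃ S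
    sp-upper : ∀ S → cutVal C̃ S ≤ cutVal C S + cutVal C S

-- (L,j)-hierarchy with respect to js : Fin (suc L) → ℕ, where "O(j_i)-tree"
-- means (K * j_i)-tree for a fixed constant K.

record Hierarchy (K n : ℕ) (G : Graph n) (L : ℕ) (js : Fin (suc L) → ℕ) : Set₁ where
  field
    Idx         : Fin (suc L) → Set          -- index set of 𝓗_i
    root        : Idx zero
    root-unique : ∀ x → x ≡ root
    parent      : (i : Fin L) → Idx (suc i) → Idx (inject₁ i)
    core        : (i : Fin L) → Idx (suc i) → Graph n
    forest      : (i : Fin L) → Idx (suc i) → Graph n
    sparse      : (i : Fin (suc L)) → Idx i → Graph n
    sparse-root : IsSparsifier2 G (sparse zero root)
    isTree      : ∀ i x → IsKTree (K * js (suc i))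
                    (vset (sparse (inject₁ i) (parent i x))) (core i x) (forest i x)
    sparse-ok   : ∀ i x → IsSparsifier2 (core i x) (sparse (suc i) x)
open Hierarchy public

record Chain {K n : ℕ} {G : Graph n} {L : ℕ} {js : Fin (suc L) → ℕ}
             (𝓗 : Hierarchy K n G L js) : Set where
  field
    h        : (i : Fin (suc L)) → Idx 𝓗 i
    h-parent : ∀ (i : Fin L) → parent 𝓗 i (h (suc i)) ≡ h (inject₁ i)
open Chain public

chainGraph : {K n : ℕ} {G : Graph n} {L : ℕ} {js : Fin (suc L) → ℕ}
             (𝓗 : Hierarchy K n G L js) → Chain 𝓗 → Graph n
chainGraph {L = L} 𝓗 ch =
  sparse 𝓗 (fromℕ L) (h ch (fromℕ L)) ∪ᴳ
  foldr (λ i acc → forest 𝓗 i (h ch (suc i)) ∪ᴳ acc) emptyGraph (allFin L)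

{-# OPTIONS --safe #-}
-- Write F for F_1 ∪ ⋯ ∪ F_L. Each F_i is a forest on V(C̃_{i-1}) rooted at
-- V(C_i) = V(C̃_i), so F_{i+1} lives on the roots of F_i. Gluing a rooted forest
-- B onto the root set R of a rooted forest A yields a rooted forest A ∪ B with
-- the roots of B: a walk factors into an A-walk to a root followed by a B-walk,
-- and since no A-walk joins two roots, a cycle in A ∪ B lies entirely in A or
-- entirely in B. By induction F is a forest on V(C̃_0) = V rooted at V(C̃_L), and
-- |V(C̃_L)| = |V(C_L)| ≤ K j, so C̃_L ∪ F is a (K j)-tree.
module Submission where

open import Defs
open import Data.Nat using (ℕ; zero; suc; _*_; _≤_; _<_)
open import Data.Nat.Properties using (suc-injective)
open import Data.Fin using (Fin; zero; suc; inject₁; fromℕ)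
open import Data.Fin.Subset using (Subset; ⊤; _∉_; _∪_; ∣_∣) renaming (_∈_ to _∈ˢ_; _⊆_ to _⊆ˢ_)
open import Data.Fin.Subset.Properties using (_∈?_; ∉⊥; x∈p∪q⁻; x∈p∪q⁺; ∪-zeroˡ)
open import Data.Rational using (0ℚ; _+_) renaming (_<_ to _<ℚ_)
open import Data.Rational.Properties using (_<?_; <-irrefl; <-≤-trans; ≮⇒≥; ≤-refl; +-mono-≤; +-mono-<-≤; +-mono-≤-<)
open import Data.List using (List; []; _∷_; _++_; [_]; length; foldr; tabulate; allFin)
open import Data.List.Properties using (++-assoc; length-++-comm; foldr-map; map-tabulate)
open import Data.List.Relation.Unary.Linked using (Linked; []; [-]; _∷_)
open import Data.List.Relation.Unary.All using (All; _∷_) renaming (lookup to All-lookup)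
open import Data.List.Relation.Unary.Any using (here; there)
open import Data.List.Relation.Unary.AllPairs using (_∷_)
open import Data.List.Relation.Unary.Unique.Propositional using (Unique)
open import Data.List.Membership.Propositional using () renaming (_∈_ to _∈ₗ_)
open import Data.List.Membership.Propositional.Properties using (∈-∃++)
open import Data.List.Relation.Binary.Permutation.Propositional using (↭⇒↭ₛ)
open import Data.List.Relation.Binary.Permutation.Propositional.Properties using () renaming (++-comm to ↭-++-comm)
open import Data.List.Relation.Binary.Permutation.Setoid.Properties using (Unique-resp-↭)
open import Data.Product using (Σ; ∃; _×_; _,_)
open import Data.Sum using (_⊎_; inj₁; inj₂; [_,_]′) renaming (map to ⊎-map)
open import Data.Empty using (⊥-elim)
open import Relation.Binary.PropositionalEquality
  using (_≡_; _≢_; refl; sym; trans; cong; cong₂; subst; setoid; module ≡-Reasoning)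
open import Relation.Nullary using (¬_; yes; no)

0<+⇒0<⊎0< : ∀ p q → 0ℚ <ℚ p + q → 0ℚ <ℚ p ⊎ 0ℚ <ℚ q
0<+⇒0<⊎0< p q 0<p+q with 0ℚ <? p | 0ℚ <? q
... | yes 0<p | _       = inj₁ 0<p
... | no _    | yes 0<q = inj₂ 0<q
... | no 0≮p  | no 0≮q  = ⊥-elim (<-irrefl refl (<-≤-trans 0<p+q (+-mono-≤ (≮⇒≥ 0≮p) (≮⇒≥ 0≮q))))

Cycle : {A : Set} → (A → A → Set) → A → List A → Set
Cycle _∼_ x xs = 2 ≤ length xs × Unique (x ∷ xs) × Linked _∼_ (x ∷ xs ++ [ x ])

module _ {A : Set} {_∼_ : A → A → Set} where

  Linked-++⁻ : ∀ xs {y} ys → Linked _∼_ (xs ++ y ∷ ys) → Linked _∼_ (xs ++ [ y ]) × Linked _∼_ (y ∷ ys)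
  Linked-++⁻ []            ys l       = [-] , l
  Linked-++⁻ (x ∷ [])      ys (e ∷ l) = e ∷ [-] , l
  Linked-++⁻ (x ∷ x′ ∷ xs) ys (e ∷ l) with Linked-++⁻ (x′ ∷ xs) ys l
  ... | l₁ , l₂ = e ∷ l₁ , l₂

  Linked-++⁺ : ∀ xs {y} ys → Linked _∼_ (xs ++ [ y ]) → Linked _∼_ (y ∷ ys) → Linked _∼_ (xs ++ y ∷ ys)
  Linked-++⁺ []            ys l₁       l₂ = l₂
  Linked-++⁺ (x ∷ [])      ys (e ∷ _)  l₂ = e ∷ l₂
  Linked-++⁺ (x ∷ x′ ∷ xs) ys (e ∷ l₁) l₂ = e ∷ Linked-++⁺ (x′ ∷ xs) ys l₁ l₂

  Cycle-rotate : ∀ {x} as {p} bs → Cycle _∼_ x (as ++ p ∷ bs) → Cycle _∼_ p (bs ++ x ∷ as)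
  Cycle-rotate {x} as {p} bs (len , uniq , l) = len′ , uniq′ , l′
    where
    len′ : 2 ≤ length (bs ++ x ∷ as)
    len′ = subst (2 ≤_) (suc-injective (length-++-comm (x ∷ as) (p ∷ bs))) len
    uniq′ : Unique (p ∷ bs ++ x ∷ as)
    uniq′ = Unique-resp-↭ (setoid A) (↭⇒↭ₛ (↭-++-comm (x ∷ as) (p ∷ bs))) uniq
    l′ : Linked _∼_ (p ∷ (bs ++ x ∷ as) ++ [ p ])
    l′ with Linked-++⁻ (x ∷ as) (bs ++ [ x ]) (subst (λ ys → Linked _∼_ (x ∷ ys)) (++-assoc as (p ∷ bs) [ x ]) l)
    ... | x⋯p , p⋯x = subst (λ ys → Linked _∼_ (p ∷ ys)) (sym (++-assoc bs (x ∷ as) [ p ]))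
                            (Linked-++⁺ (p ∷ bs) (as ++ [ p ]) p⋯x x⋯p)

Acyclic-intro : ∀ {n} {G : Graph n} → (∀ x xs → ¬ Cycle (Edge G) x xs) → Acyclic G
Acyclic-intro noCycle x xs len uniq l = noCycle x xs (len , uniq , l)

module _ {n : ℕ} where

  Reach-trans : ∀ {G : Graph n} {u v w} → Reach G u v → Reach G v w → Reach G u w
  Reach-trans here       r′ = r′
  Reach-trans (step e r) r′ = step e (Reach-trans r r′)

  Reach-mono : ∀ {G H : Graph n} → (∀ {u v} → Edge G u v → Edge H u v) → ∀ {u v} → Reach G u v → Reach H u v
  Reach-mono f here       = here
  Reach-mono f (step e r) = step (f e) (Reach-mono f r)

  Linked⇒Reach : ∀ {G : Graph n} {x} xs {t} → Linked (Edge G) (x ∷ xs ++ [ t ]) → Reach G x t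
  Linked⇒Reach []       (e ∷ [-]) = step e here
  Linked⇒Reach (_ ∷ xs) (e ∷ l)   = step e (Linked⇒Reach xs l)

  Reach-empty : ∀ {u v : Fin n} → Reach emptyGraph u v → u ≡ v
  Reach-empty here       = refl
  Reach-empty (step e _) = ⊥-elim (<-irrefl refl e)

  Edge-∪⁻ : ∀ (G H : Graph n) u v → Edge (G ∪ᴳ H) u v → Edge G u v ⊎ Edge H u v
  Edge-∪⁻ G H u v = 0<+⇒0<⊎0< (cap G u v) (cap H u v)

  module _ {G H : Graph n} where

    Reach-∪⁺ˡ : IsGraph H → ∀ {u v} → Reach G u v → Reach (G ∪ᴳ H) u v
    Reach-∪⁺ˡ isH = Reach-mono λ {u} {v} e → +-mono-<-≤ e (IsGraph.cap-nonneg isH u v)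

    Reach-∪⁺ʳ : IsGraph G → ∀ {u v} → Reach H u v → Reach (G ∪ᴳ H) u v
    Reach-∪⁺ʳ isG = Reach-mono λ {u} {v} e → +-mono-≤-< (IsGraph.cap-nonneg isG u v) e

    IsGraph-∪ : IsGraph G → IsGraph H → IsGraph (G ∪ᴳ H)
    IsGraph-∪ isG isH = record
      { cap-nonneg = λ u v → +-mono-≤ (G.cap-nonneg u v) (H.cap-nonneg u v)
      ; cap-sym    = λ u v → cong₂ _+_ (G.cap-sym u v) (H.cap-sym u v)
      ; cap-loop   = λ u → cong₂ _+_ (G.cap-loop u) (H.cap-loop u)
      ; cap-supp   = λ u v e → supp (Edge-∪⁻ G H u v e)
      }
      where
      module G = IsGraph isG
      module H = IsGraph isH
      supp : ∀ {u v} → Edge G u v ⊎ Edge H u v → (u ∈ˢ vset G ∪ vset H) × (v ∈ˢ vset G ∪ vset H)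
      supp {u} {v} (inj₁ e) with G.cap-supp u v e
      ... | u∈ , v∈ = x∈p∪q⁺ (inj₁ u∈) , x∈p∪q⁺ (inj₁ v∈)
      supp {u} {v} (inj₂ e) with H.cap-supp u v e
      ... | u∈ , v∈ = x∈p∪q⁺ (inj₂ u∈) , x∈p∪q⁺ (inj₂ v∈)

  IsGraph-empty : IsGraph (emptyGraph {n})
  IsGraph-empty = record
    { cap-nonneg = λ _ _ → ≤-refl
    ; cap-sym    = λ _ _ → refl
    ; cap-loop   = λ _ → refl
    ; cap-supp   = λ _ _ e → ⊥-elim (<-irrefl refl e)
    }

module AcyclicGlue {n : ℕ} (A B : Graph n) (R : Subset n)
  (R-separated : ∀ {r r′} → r ∈ˢ R → r′ ∈ˢ R → Reach A r r′ → r ≡ r′)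
  (B-inside : ∀ {u v} → Edge B u v → u ∈ˢ R × v ∈ˢ R)
  (A-acyclic : Acyclic A) (B-acyclic : Acyclic B) where

  private
    E : Fin n → Fin n → Set
    E = Edge (A ∪ᴳ B)

  A-edgeˡ : ∀ {u v} → u ∉ R → E u v → Edge A u v
  A-edgeˡ {u} {v} u∉R e with Edge-∪⁻ A B u v e
  ... | inj₁ a = a
  ... | inj₂ b with B-inside b
  ...   | u∈R , _ = ⊥-elim (u∉R u∈R)

  A-edgeʳ : ∀ {u v} → v ∉ R → E u v → Edge A u v
  A-edgeʳ {u} {v} v∉R e with Edge-∪⁻ A B u v e
  ... | inj₁ a = a
  ... | inj₂ b with B-inside b
  ...   | _ , v∈R = ⊥-elim (v∉R v∈R)

  walk-from-outside : ∀ zs {y t} → y ∉ R → Linked E (y ∷ zs ++ [ t ]) →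
    (∃ λ q → q ∈ₗ zs × q ∈ˢ R × Reach A y q) ⊎ Linked (Edge A) (y ∷ zs ++ [ t ])
  walk-from-outside []       y∉R (e ∷ [-]) = inj₂ (A-edgeˡ y∉R e ∷ [-])
  walk-from-outside (z ∷ zs) y∉R (e ∷ l) with z ∈? R
  ... | yes z∈R = inj₁ (z , here refl , z∈R , step (A-edgeˡ y∉R e) here)
  ... | no z∉R with walk-from-outside zs z∉R l
  ...   | inj₁ (q , q∈zs , q∈R , z⇝q) = inj₁ (q , there q∈zs , q∈R , step (A-edgeˡ y∉R e) z⇝q)
  ...   | inj₂ l′ = inj₂ (A-edgeˡ y∉R e ∷ l′)

  -- A detour through A between two distinct roots would join their A-components.
  walk-between-roots : ∀ ws {s x} → s ∈ˢ R → x ∈ˢ R → All (s ≢_) ws → All (x ≢_) ws → Unique ws →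
    Linked E (s ∷ ws ++ [ x ]) → Linked (Edge A) (s ∷ ws ++ [ x ]) ⊎ Linked (Edge B) (s ∷ ws ++ [ x ])
  walk-between-roots [] {s} {x} _ _ _ _ _ (e ∷ [-]) = ⊎-map (_∷ [-]) (_∷ [-]) (Edge-∪⁻ A B s x e)
  walk-between-roots (w ∷ ws) {s} s∈R x∈R (s≢w ∷ s∉ws) (x≢w ∷ x∉ws) (w∉ws ∷ uniq) (e ∷ l) with w ∈? R
  ... | yes w∈R with walk-between-roots ws w∈R x∈R w∉ws x∉ws uniq l
  ...   | inj₁ a = ⊥-elim (x≢w (sym (R-separated w∈R x∈R (Linked⇒Reach ws a))))
  ...   | inj₂ b with Edge-∪⁻ A B s w e
  ...     | inj₁ ea = ⊥-elim (s≢w (R-separated s∈R w∈R (step ea here)))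
  ...     | inj₂ eb = inj₂ (eb ∷ b)
  walk-between-roots (w ∷ ws) {s} s∈R x∈R (s≢w ∷ s∉ws) _ _ (e ∷ l) | no w∉R
    with walk-from-outside ws w∉R l
  ... | inj₁ (q , q∈ws , q∈R , w⇝q) =
          ⊥-elim (All-lookup s∉ws q∈ws (R-separated s∈R q∈R (step (A-edgeʳ w∉R e) w⇝q)))
  ... | inj₂ a = inj₁ (A-edgeʳ w∉R e ∷ a)

  no-cycle-at-root : ∀ {x xs} → x ∈ˢ R → ¬ Cycle E x xs
  no-cycle-at-root {x} {xs} x∈R (len , uniq@(x∉xs ∷ uniq′) , l) =
    [ A-acyclic x xs len uniq , B-acyclic x xs len uniq ]′
      (walk-between-roots xs x∈R x∈R x∉xs x∉xs uniq′ l)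

  acyclic : Acyclic (A ∪ᴳ B)
  acyclic = Acyclic-intro {G = A ∪ᴳ B} noCycle
    where
    noCycle : ∀ x xs → ¬ Cycle E x xs
    noCycle x xs c@(len , uniq , l) with x ∈? R
    ... | yes x∈R = no-cycle-at-root x∈R c
    ... | no x∉R with walk-from-outside xs x∉R l
    ...   | inj₂ a = A-acyclic x xs len uniq a
    ...   | inj₁ (p , p∈xs , p∈R , _) with ∈-∃++ p∈xs
    ...     | as , bs , refl = no-cycle-at-root p∈R (Cycle-rotate as bs c)

-- The vertex set of T is only required to lie inside D, so that the empty
-- graph is a rooted forest on D with every vertex of D a root.
record RootedForest {n : ℕ} (D R : Subset n) (T : Graph n) : Set where
  field
    isGraph     : IsGraph T
    vset⊆       : vset T ⊆ˢ D
    acyclic     : Acyclic T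
    roots⊆      : R ⊆ˢ D
    reach-root  : ∀ v → v ∈ˢ D → Σ (Fin n) λ r → (r ∈ˢ R) × Reach T v r
    unique-root : ∀ v r r′ → v ∈ˢ D → r ∈ˢ R → Reach T v r → r′ ∈ˢ R → Reach T v r′ → r ≡ r′

  roots-separated : ∀ {r r′} → r ∈ˢ R → r′ ∈ˢ R → Reach T r r′ → r ≡ r′
  roots-separated {r} {r′} r∈R r′∈R r⇝r′ = unique-root r r r′ (roots⊆ r∈R) r∈R here r′∈R r⇝r′

module _ {n : ℕ} where

  IsKTree⇒RootedForest : ∀ {k W} {C F : Graph n} → IsKTree k W C F → RootedForest W (vset C) F
  IsKTree⇒RootedForest t = record
    { isGraph     = T.forest-graph
    ; vset⊆       = λ {v} v∈F → subst (v ∈ˢ_) T.forest-on v∈F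
    ; acyclic     = T.forest-acyc
    ; roots⊆      = T.core-sub
    ; reach-root  = T.root-exists
    ; unique-root = T.root-unique
    }
    where module T = IsKTree t

  RootedForest⇒IsKTree : ∀ {k W} {C F : Graph n} → IsGraph C → ∣ vset C ∣ ≤ k → vset F ≡ W →
    RootedForest W (vset C) F → IsKTree k W C F
  RootedForest⇒IsKTree isC size vF t = record
    { core-graph   = isC
    ; forest-graph = T.isGraph
    ; core-sub     = T.roots⊆
    ; core-size    = size
    ; forest-on    = vF
    ; forest-acyc  = T.acyclic
    ; root-exists  = T.reach-root
    ; root-unique  = T.unique-root
    }
    where module T = RootedForest t

  RootedForest-empty : ∀ (D : Subset n) → RootedForest D D emptyGraph
  RootedForest-empty D = record
    { isGraph     = IsGraph-empty
    ; vset⊆       = λ v∈⊥ → ⊥-elim (∉⊥ v∈⊥)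
    ; acyclic     = λ { _ (_ ∷ _) _ _ (e ∷ _) → <-irrefl refl e }
    ; roots⊆      = λ r∈D → r∈D
    ; reach-root  = λ v v∈D → v , v∈D , here
    ; unique-root = λ _ _ _ _ _ v⇝r _ v⇝r′ → trans (sym (Reach-empty v⇝r)) (Reach-empty v⇝r′)
    }

  RootedForest-∪ : ∀ {W R Rf} {A B : Graph n} →
    RootedForest W R A → RootedForest R Rf B → RootedForest W Rf (A ∪ᴳ B)
  RootedForest-∪ {W} {R} {Rf} {A} {B} tA tB = record
    { isGraph     = IsGraph-∪ A.isGraph B.isGraph
    ; vset⊆       = vset⊆
    ; acyclic     = AcyclicGlue.acyclic A B R A.roots-separated B-inside A.acyclic B.acyclic
    ; roots⊆      = λ r∈Rf → A.roots⊆ (B.roots⊆ r∈Rf)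
    ; reach-root  = reach-root
    ; unique-root = unique-root
    }
    where
    module A = RootedForest tA
    module B = RootedForest tB

    B-inside : ∀ {u v} → Edge B u v → u ∈ˢ R × v ∈ˢ R
    B-inside {u} {v} e with IsGraph.cap-supp B.isGraph u v e
    ... | u∈B , v∈B = B.vset⊆ u∈B , B.vset⊆ v∈B

    vset⊆ : vset A ∪ vset B ⊆ˢ W
    vset⊆ v∈A∪B with x∈p∪q⁻ (vset A) (vset B) v∈A∪B
    ... | inj₁ v∈A = A.vset⊆ v∈A
    ... | inj₂ v∈B = A.roots⊆ (B.vset⊆ v∈B)

    reach-root : ∀ v → v ∈ˢ W → Σ (Fin n) λ r → (r ∈ˢ Rf) × Reach (A ∪ᴳ B) v r
    reach-root v v∈W with A.reach-root v v∈W
    ... | r , r∈R , v⇝r with B.reach-root r r∈R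
    ...   | rf , rf∈Rf , r⇝rf =
              rf , rf∈Rf , Reach-trans (Reach-∪⁺ˡ B.isGraph v⇝r) (Reach-∪⁺ʳ A.isGraph r⇝rf)

    -- An A-walk between two roots returns to its start, so any A-segment after a
    -- B-edge can be dropped.
    factor : ∀ {v t} → t ∈ˢ R → Reach (A ∪ᴳ B) v t → Σ (Fin n) λ r → r ∈ˢ R × Reach A v r × Reach B r t
    factor t∈R here = _ , t∈R , here , here
    factor {v} t∈R (step {w = w} e w⇝t) with factor t∈R w⇝t | Edge-∪⁻ A B v w e
    ... | r , r∈R , w⇝r , r⇝t | inj₁ ea = r , r∈R , step ea w⇝r , r⇝t
    ... | r , r∈R , w⇝r , r⇝t | inj₂ eb with B-inside eb
    ...   | v∈R , w∈R with A.roots-separated w∈R r∈R w⇝r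
    ...     | refl = _ , v∈R , here , step eb r⇝t

    unique-root : ∀ v r r′ → v ∈ˢ W → r ∈ˢ Rf → Reach (A ∪ᴳ B) v r → r′ ∈ˢ Rf → Reach (A ∪ᴳ B) v r′ → r ≡ r′
    unique-root v r r′ v∈W r∈Rf v⇝r r′∈Rf v⇝r′
      with factor (B.roots⊆ r∈Rf) v⇝r | factor (B.roots⊆ r′∈Rf) v⇝r′
    ... | a , a∈R , v⇝a , a⇝r | b , b∈R , v⇝b , b⇝r′ with A.unique-root v a b v∈W a∈R v⇝a b∈R v⇝b
    ...   | refl = B.unique-root a r r′ a∈R r∈Rf a⇝r r′∈Rf b⇝r′

  ⋃ᴳ : ∀ {m} → (Fin m → Graph n) → Graph n
  ⋃ᴳ F = foldr _∪ᴳ_ emptyGraph (tabulate F)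

  RootedForest-⋃ : ∀ m (D : Fin (suc m) → Subset n) (F : Fin m → Graph n) →
    (∀ i → RootedForest (D (inject₁ i)) (D (suc i)) (F i)) → RootedForest (D zero) (D (fromℕ m)) (⋃ᴳ F)
  RootedForest-⋃ zero    D F t = RootedForest-empty (D zero)
  RootedForest-⋃ (suc m) D F t =
    RootedForest-∪ (t zero) (RootedForest-⋃ m (λ i → D (suc i)) (λ i → F (suc i)) (λ i → t (suc i)))

module _ {K n : ℕ} {G : Graph n} {L : ℕ} {js : Fin (suc L) → ℕ}
         (𝓗 : Hierarchy K n G L js) (ch : Chain 𝓗) where

  level : Fin (suc L) → Subset n
  level i = vset (sparse 𝓗 i (h ch i))

  chainForest : Fin L → Graph n
  chainForest i = forest 𝓗 i (h ch (suc i))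

  chainCore : Fin L → Graph n
  chainCore i = core 𝓗 i (h ch (suc i))

  level-zero : level zero ≡ vset G
  level-zero = trans (cong (λ x → vset (sparse 𝓗 zero x)) (root-unique 𝓗 (h ch zero)))
                     (IsSparsifier2.sp-vset (sparse-root 𝓗))

  level-suc : ∀ i → level (suc i) ≡ vset (chainCore i)
  level-suc i = IsSparsifier2.sp-vset (sparse-ok 𝓗 i (h ch (suc i)))

  chainTree : ∀ i → IsKTree (K * js (suc i)) (level (inject₁ i)) (chainCore i) (chainForest i)
  chainTree i = subst (λ x → IsKTree (K * js (suc i)) (vset (sparse 𝓗 (inject₁ i) x)) (chainCore i) (chainForest i))
                      (h-parent ch i) (isTree 𝓗 i (h ch (suc i)))

  chainForest-rooted : ∀ i → RootedForest (level (inject₁ i)) (level (suc i)) (chainForest i)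
  chainForest-rooted i = subst (λ R → RootedForest (level (inject₁ i)) R (chainForest i))
                               (sym (level-suc i)) (IsKTree⇒RootedForest (chainTree i))

  chainForests : Graph n
  chainForests = foldr (λ i acc → chainForest i ∪ᴳ acc) emptyGraph (allFin L)

  chainForests≡⋃ : chainForests ≡ ⋃ᴳ chainForest
  chainForests≡⋃ = trans (sym (foldr-map _∪ᴳ_ chainForest emptyGraph (allFin L)))
                         (cong (foldr _∪ᴳ_ emptyGraph) (map-tabulate (λ i → i) chainForest))

  chainForests-rooted : RootedForest (level zero) (level (fromℕ L)) chainForests
  chainForests-rooted = subst (RootedForest (level zero) (level (fromℕ L))) (sym chainForests≡⋃)
                              (RootedForest-⋃ L level chainForest chainForest-rooted)

module _ {K n : ℕ} {G : Graph n} {m : ℕ} {js : Fin (suc (suc m)) → ℕ}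
         (𝓗 : Hierarchy K n G (suc m) js) (ch : Chain 𝓗) (vG : vset G ≡ ⊤) where

  private
    top = fromℕ m
    level-zero-⊤ : level 𝓗 ch zero ≡ ⊤
    level-zero-⊤ = trans (level-zero 𝓗 ch) vG

  chainForests-spanning : vset (chainForests 𝓗 ch) ≡ ⊤
  chainForests-spanning =
    begin
      vset (chainForests 𝓗 ch)                           ≡⟨ cong vset (chainForests≡⋃ 𝓗 ch) ⟩
      vset (chainForest 𝓗 ch zero) ∪ vset (⋃ᴳ later)    ≡⟨ cong (_∪ vset (⋃ᴳ later)) first-forest-⊤ ⟩
      ⊤ ∪ vset (⋃ᴳ later)                                ≡⟨ ∪-zeroˡ _ ⟩
      ⊤                                                  ∎
    where
    open ≡-Reasoning
    later : Fin m → Graph n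
    later i = chainForest 𝓗 ch (suc i)
    first-forest-⊤ : vset (chainForest 𝓗 ch zero) ≡ ⊤
    first-forest-⊤ = trans (IsKTree.forest-on (chainTree 𝓗 ch zero)) level-zero-⊤

  chainGraph-isKTree : IsKTree (K * js (fromℕ (suc m))) ⊤ (sparse 𝓗 (fromℕ (suc m)) (h ch (fromℕ (suc m))))
                                                          (chainForests 𝓗 ch)
  chainGraph-isKTree =
    RootedForest⇒IsKTree (IsSparsifier2.sp-graph (sparse-ok 𝓗 top (h ch (suc top))))
      (subst (λ S → ∣ S ∣ ≤ K * js (suc top)) (sym (level-suc 𝓗 ch top)) (IsKTree.core-size (chainTree 𝓗 ch top)))
      chainForests-spanning
      (subst (λ D → RootedForest D (level 𝓗 ch (fromℕ (suc m))) (chainForests 𝓗 ch)) level-zero-⊤ (chainForests-rooted 𝓗 ch))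

mainTheorem1 : (K : ℕ) → Σ ℕ λ K' →
    (n : ℕ) (G : Graph n) → IsGraph G → vset G ≡ ⊤ →
    (L j : ℕ) → 1 ≤ j → j ≤ n → 1 ≤ L → L ≤ n →
    (js : Fin (suc L) → ℕ) → js zero ≡ n → js (fromℕ L) ≡ j →
    (∀ (i : Fin L) → js (suc i) < js (inject₁ i)) →
    (𝓗 : Hierarchy K n G L js) (ch : Chain 𝓗) →
    Σ (Graph n) λ C → Σ (Graph n) λ F →
      IsKTree (K' * j) ⊤ C F × SameGraph (C ∪ᴳ F) (chainGraph 𝓗 ch)
-- K′ = K works; of the hypotheses only V(G) = V, L ≥ 1 (so that F_1 spans V)
-- and j_L = j are needed.
mainTheorem1 K = K , λ where
  n G _ vG (suc m) j _ _ _ _ js _ jL _ 𝓗 ch →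
    _ , _ , subst (λ t → IsKTree (K * t) ⊤ _ _) jL (chainGraph-isKTree 𝓗 ch vG) , refl , λ _ _ → refl
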